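{- For all integers $m,n\ge0$, the bubble lattice $\mathrm{Bub}(m,n)$ has order dimension $m+n$.
   Context: For a finite directed graph $G$, a maximal orthogonal pair is a pair $(X,Y)$ of disjoint vertex sets with no edge from $X$ to $Y$, maximal for componentwise inclusion; $L(G)$ is the set of these ordered by $(X,Y)\le(X',Y')$ iff $X\subseteq X'$. Let $X=\{x_1,\dots,x_m\}$ and $Y=\{y_1,\dots,y_n\}$ be disjoint alphabets. $\mathrm{Bub}(m,n)=L(G)$ where $G$ has vertex set $X\sqcup Y\sqcup(X\times Y)$ and an edge $l_1\to l_2$, for $l_1\ne l_2$, iff either $l_1=(x_s,y_t)$ and $l_2=x_s$; or $l_1=y_t$ and $l_2=(x_s,y_t)$; or $l_1=(x_s,y_t)$, $l_2=(x_{s'},y_{t'})$ with $s\ge s'$ and $t\le t'$. The order dimension of a poset $P$ is the smallest $d$ such that $P$ is isomorphic to a subposet of $\mathbb R^d$ with componentwise order.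
   Formalization: The order dimension is defined through embeddings into ℚ^d with the componentwise order instead of ℝ^d. -}

module Defs where

open import Level using (Level; 0ℓ) renaming (suc to lsuc)
open import Data.Nat using (ℕ) renaming (_≤_ to _≤ℕ_)
open import Data.Fin using (Fin) renaming (_≤_ to _≤F_)
open import Data.Bool using (Bool; true; false)
open import Data.Sum using (_⊎_; inj₁; inj₂)
open import Data.Product using (Σ; _×_; _,_; proj₁)
open import Data.Empty using (⊥)
open import Relation.Binary.PropositionalEquality using (_≡_)
open import Relation.Nullary using (¬_)
open import Function.Bundles using (_⇔_)
open import Data.Rational using (ℚ) renaming (_≤_ to _≤ℚ_)

record Digraph : Set₁ where
  field
    Vertex : Set
    Edge   : Vertex → Vertex → Set

Subset : Set → Set
Subset V = V → Bool

_⊆_ : {V : Set} → Subset V → Subset V → Set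
A ⊆ B = ∀ v → A v ≡ true → B v ≡ true

module _ (G : Digraph) where
  open Digraph G

  IsOrthogonal : Subset Vertex → Subset Vertex → Set
  IsOrthogonal X Y =
    (∀ v → X v ≡ true → Y v ≡ true → ⊥) ×
    (∀ a b → X a ≡ true → Y b ≡ true → ¬ Edge a b)

  IsMaxOrthogonal : Subset Vertex → Subset Vertex → Set
  IsMaxOrthogonal X Y =
    IsOrthogonal X Y ×
    (∀ X' Y' → IsOrthogonal X' Y' → X ⊆ X' → Y ⊆ Y' → (X' ⊆ X) × (Y' ⊆ Y))

  MOP : Set
  MOP = Σ (Subset Vertex × Subset Vertex)
          (λ XY → IsMaxOrthogonal (Data.Product.proj₁ XY) (Data.Product.proj₂ XY))

  _≤L_ : MOP → MOP → Set
  ((X , _) , _) ≤L ((X' , _) , _) = X ⊆ X'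

record OrderedSet : Set₁ where
  field
    Carrier : Set
    _≤_     : Carrier → Carrier → Set

L : Digraph → OrderedSet
L G = record { Carrier = MOP G ; _≤_ = _≤L_ G }

EmbedsIn : OrderedSet → ℕ → Set
EmbedsIn P d = Σ (Carrier → (Fin d → ℚ))
  (λ f → ∀ p q → (p ≤ q) ⇔ (∀ i → f p i ≤ℚ f q i))
  where open OrderedSet P

HasOrderDimension : OrderedSet → ℕ → Set
HasOrderDimension P d = EmbedsIn P d × (∀ d' → EmbedsIn P d' → d ≤ℕ d')

-- Vertices: X ⊔ Y ⊔ (X × Y), with X = {x_0..x_{m-1}}, Y = {y_0..y_{n-1}}.
BubVertex : ℕ → ℕ → Set
BubVertex m n = Fin m ⊎ (Fin n ⊎ (Fin m × Fin n))

BubEdge : (m n : ℕ) → BubVertex m n → BubVertex m n → Set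
-- (x_s , y_t) → x_s
BubEdge m n (inj₂ (inj₂ (s , t))) (inj₁ s') = s ≡ s'
-- y_t → (x_s , y_t)
BubEdge m n (inj₂ (inj₁ t)) (inj₂ (inj₂ (s , t'))) = t ≡ t'
-- (x_s , y_t) → (x_s' , y_t') when distinct, s ≥ s', t ≤ t'
BubEdge m n (inj₂ (inj₂ (s , t))) (inj₂ (inj₂ (s' , t'))) =
  ¬ ((s ≡ s') × (t ≡ t')) × (s' ≤F s) × (t ≤F t')
BubEdge m n _ _ = ⊥

BubGraph : ℕ → ℕ → Digraph
BubGraph m n = record { Vertex = BubVertex m n ; Edge = BubEdge m n }

Bub : ℕ → ℕ → OrderedSet
Bub m n = L (BubGraph m n)

module Submission where

-- Upper bound: call b dominated by a if a → b and every out-neighbour of b is also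
-- one of a. The X-side of a maximal orthogonal pair is closed under domination. Each
-- x_s together with its row (s,0), …, (s,n-1), and each y_t alone, is a chain for
-- domination ((s,t) dominates x_s and every (s,t') with t < t'), so the traces of the
-- X-sides on these m + n columns are nested, and their sizes give an order embedding
-- into ℕ^(m+n).
-- Lower bound: for each letter ℓ, the pairs ({ℓ}, ·) and (·, {ℓ}) complete to maximal
-- pairs a_ℓ and b_ℓ with a_ℓ ≤ b_ℓ' exactly when ℓ ≠ ℓ'. An embedding into ℚ^d needs,
-- for every ℓ, a coordinate where a_ℓ exceeds b_ℓ, and no two letters can share one.

open import Defs
open import Data.Nat as ℕ using (ℕ; zero; suc; _+_; z≤n; s≤s)
import Data.Nat.Properties as ℕ
open import Data.Fin as Fin using (Fin; zero; suc)
import Data.Fin.Properties as Fin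
open import Data.Bool using (true; false; not; _∨_)
open import Data.Bool.Properties using (not-injective; not-involutive)
open import Data.Sum using (_⊎_; inj₁; inj₂)
import Data.Sum.Properties as Sum
import Data.Product.Properties as Product
open import Data.Product using (_×_; _,_; proj₁; proj₂; ∃-syntax)
open import Data.Empty using (⊥; ⊥-elim)
open import Data.Integer as ℤ using (+_)
import Data.Integer.Properties as ℤ
open import Data.Rational using (ℚ; *≤*) renaming (_≤_ to _≤ℚ_; _<_ to _<ℚ_)
import Data.Rational.Properties as ℚ
open import Data.Rational.Literals using (fromℤ)
open import Function using (_∘_; id)
open import Function.Bundles using (_⇔_; mk⇔; Equivalence; _↔_; Inverse; _↣_; Injection)
open import Function.Properties.Inverse using (↔⇒↣)
open import Relation.Binary.Definitions using (DecidableEquality; tri<; tri≈; tri>)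
open import Relation.Binary.PropositionalEquality
open import Relation.Nullary using (¬_; yes; no; does; contradiction)
open import Relation.Nullary.Decidable using (dec-true; dec-false)

size : ∀ {k} → Subset (Fin k) → ℕ
size {zero}  A = 0
size {suc k} A with A zero
... | true  = suc (size (A ∘ suc))
... | false = size (A ∘ suc)

Comparable : {V : Set} → Subset V → Subset V → Set
Comparable A B = A ⊆ B ⊎ B ⊆ A

size-mono : ∀ {k} {A B : Subset (Fin k)} → A ⊆ B → size A ℕ.≤ size B
size-mono {zero}          A⊆B = z≤n
size-mono {suc k} {A} {B} A⊆B with A zero in a₀ | B zero in b₀
... | true  | true  = s≤s (size-mono (A⊆B ∘ suc))
... | true  | false = contradiction (trans (sym b₀) (A⊆B zero a₀)) λ ()
... | false | true  = ℕ.m≤n⇒m≤1+n (size-mono (A⊆B ∘ suc))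
... | false | false = size-mono (A⊆B ∘ suc)

⊆-by-size : ∀ {k} {A B : Subset (Fin k)} → B ⊆ A → size A ℕ.≤ size B → A ⊆ B
⊆-by-size {zero}          B⊆A ∣A∣≤∣B∣ ()
⊆-by-size {suc k} {A} {B} B⊆A ∣A∣≤∣B∣ with A zero in a₀ | B zero in b₀
... | false | true  = contradiction (trans (sym a₀) (B⊆A zero b₀)) λ ()
... | true  | false = contradiction (size-mono (B⊆A ∘ suc)) (ℕ.<⇒≱ ∣A∣≤∣B∣)
... | true  | true  = λ { zero _ → b₀
                        ; (suc i) → ⊆-by-size (B⊆A ∘ suc) (ℕ.s≤s⁻¹ ∣A∣≤∣B∣) i }
... | false | false = λ { zero 0∈A → contradiction (trans (sym a₀) 0∈A) λ ()
                        ; (suc i) → ⊆-by-size (B⊆A ∘ suc) ∣A∣≤∣B∣ i }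

comparable⇒⊆⇔size≤ : ∀ {k} {A B : Subset (Fin k)} → Comparable A B →
                      A ⊆ B ⇔ size A ℕ.≤ size B
comparable⇒⊆⇔size≤ (inj₁ A⊆B) = mk⇔ size-mono (λ _ → A⊆B)
comparable⇒⊆⇔size≤ (inj₂ B⊆A) = mk⇔ size-mono (⊆-by-size B⊆A)

⊆-or-counterexample : ∀ {k} (A B : Subset (Fin k)) →
                      A ⊆ B ⊎ ∃[ i ] (A i ≡ true × B i ≡ false)
⊆-or-counterexample {zero}  A B = inj₁ λ ()
⊆-or-counterexample {suc k} A B with ⊆-or-counterexample (A ∘ suc) (B ∘ suc)
... | inj₂ (i , i∈A , i∉B) = inj₂ (suc i , i∈A , i∉B)
... | inj₁ tail⊆ with A zero in a₀ | B zero in b₀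
...   | true  | false = inj₂ (zero , a₀ , b₀)
...   | true  | true  = inj₁ λ { zero _ → b₀ ; (suc i) → tail⊆ i }
...   | false | _     = inj₁ λ { zero 0∈A → contradiction (trans (sym a₀) 0∈A) λ ()
                               ; (suc i) → tail⊆ i }

module _ {V Λ : Set} {width : Λ → ℕ} (column : (ℓ : Λ) → Fin (width ℓ) → V)
         (columns-cover : ∀ v → ∃[ ℓ ] ∃[ i ] column ℓ i ≡ v) where

  ⊆⇔column-sizes≤ : {X X' : Subset V} →
                    (∀ ℓ → Comparable (X ∘ column ℓ) (X' ∘ column ℓ)) →
                    X ⊆ X' ⇔ (∀ ℓ → size (X ∘ column ℓ) ℕ.≤ size (X' ∘ column ℓ))
  ⊆⇔column-sizes≤ {X} {X'} comparable =
    mk⇔ (λ X⊆X' ℓ → size-mono (X⊆X' ∘ column ℓ)) from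
    where
    from : (∀ ℓ → size (X ∘ column ℓ) ℕ.≤ size (X' ∘ column ℓ)) → X ⊆ X'
    from sizes≤ v with columns-cover v
    ... | ℓ , i , refl = Equivalence.from (comparable⇒⊆⇔size≤ (comparable ℓ)) (sizes≤ ℓ) i

ℕ→ℚ : ℕ → ℚ
ℕ→ℚ n = fromℤ (+ n)

ℕ→ℚ-mono-≤ : ∀ {a b} → a ℕ.≤ b → ℕ→ℚ a ≤ℚ ℕ→ℚ b
ℕ→ℚ-mono-≤ {a} {b} a≤b =
  *≤* (subst₂ ℤ._≤_ (sym (ℤ.*-identityʳ (+ a))) (sym (ℤ.*-identityʳ (+ b))) (ℤ.+≤+ a≤b))

ℕ→ℚ-cancel-≤ : ∀ {a b} → ℕ→ℚ a ≤ℚ ℕ→ℚ b → a ℕ.≤ b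
ℕ→ℚ-cancel-≤ {a} {b} (*≤* a≤b) =
  ℤ.drop‿+≤+ (subst₂ ℤ._≤_ (ℤ.*-identityʳ (+ a)) (ℤ.*-identityʳ (+ b)) a≤b)

module _ (P : OrderedSet) where
  open OrderedSet P

  embedsIn-ℕ : ∀ {d} {I : Set} → Fin d ↔ I → (f : Carrier → I → ℕ) →
               (∀ p q → p ≤ q ⇔ (∀ i → f p i ℕ.≤ f q i)) → EmbedsIn P d
  embedsIn-ℕ coordinates f f-embedding =
    (λ p κ → ℕ→ℚ (f p (to κ))) ,
    λ p q → mk⇔ (λ p≤q κ → ℕ→ℚ-mono-≤ (Equivalence.to (f-embedding p q) p≤q (to κ)))
                (λ f≤ → Equivalence.from (f-embedding p q) λ i →
                   subst (λ j → f p j ℕ.≤ f q j) (strictlyInverseˡ i) (ℕ→ℚ-cancel-≤ (f≤ (from i))))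
    where open Inverse coordinates

  standard-example⇒≤ : ∀ {k d} {I : Set} → Fin k ↣ I → (a b : I → Carrier) →
                       (∀ i j → i ≢ j → a i ≤ b j) → (∀ i → ¬ a i ≤ b i) →
                       EmbedsIn P d → k ℕ.≤ d
  standard-example⇒≤ {k} {d} e a b aᵢ≤bⱼ aᵢ≰bᵢ (f , f-embedding) = Fin.injective⇒≤ κ-injective
    where
    open Injection e using (to; injective)
    open ℚ.≤-Reasoning

    witness : ∀ i → ∃[ κ ] ¬ f (a (to i)) κ ≤ℚ f (b (to i)) κ
    witness i = Fin.¬∀⟶∃¬ d _ (λ κ → f (a (to i)) κ ℚ.≤? f (b (to i)) κ)
                  (aᵢ≰bᵢ (to i) ∘ Equivalence.from (f-embedding _ _))

    κ : Fin k → Fin d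
    κ = proj₁ ∘ witness

    κ-injective : ∀ {i j} → κ i ≡ κ j → i ≡ j
    κ-injective {i} {j} κi≡κj with i Fin.≟ j
    ... | yes i≡j = i≡j
    ... | no i≢j = ⊥-elim (ℚ.<-irrefl refl cycle)
      where
      c : Fin d
      c = κ i
      bⱼ<aⱼ : f (b (to j)) c <ℚ f (a (to j)) c
      bⱼ<aⱼ = subst (λ c → f (b (to j)) c <ℚ f (a (to j)) c) (sym κi≡κj)
                (ℚ.≰⇒> (proj₂ (witness j)))
      cycle : f (b (to i)) c <ℚ f (b (to i)) c
      cycle = begin-strict
        f (b (to i)) c  <⟨ ℚ.≰⇒> (proj₂ (witness i)) ⟩
        f (a (to i)) c  ≤⟨ Equivalence.to (f-embedding _ _) (aᵢ≤bⱼ _ _ (i≢j ∘ injective)) c ⟩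
        f (b (to j)) c  <⟨ bⱼ<aⱼ ⟩
        f (a (to j)) c  ≤⟨ Equivalence.to (f-embedding _ _) (aᵢ≤bⱼ _ _ (i≢j ∘ sym ∘ injective)) c ⟩
        f (b (to i)) c  ∎

module _ (G : Digraph) where
  open Digraph G

  Dominates : Vertex → Vertex → Set
  Dominates a b = Edge a b × (∀ c → Edge b c → Edge a c)

  IsDominationChain : ∀ {k} → (Fin k → Vertex) → Set
  IsDominationChain c = ∀ i j → i ≢ j → Dominates (c i) (c j) ⊎ Dominates (c j) (c i)

  blocked⇒maximal : {X Y : Subset Vertex} → IsOrthogonal G X Y →
                    (∀ v → X v ≡ false → Y v ≡ true ⊎ ∃[ b ] (Y b ≡ true × Edge v b)) →
                    (∀ v → Y v ≡ false → X v ≡ true ⊎ ∃[ a ] (X a ≡ true × Edge a v)) →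
                    IsMaxOrthogonal G X Y
  blocked⇒maximal {X} {Y} orthogonal X-blocked Y-blocked = orthogonal , maximal
    where
    maximal : ∀ X' Y' → IsOrthogonal G X' Y' → X ⊆ X' → Y ⊆ Y' → X' ⊆ X × Y' ⊆ Y
    maximal X' Y' (disjoint , no-edge) X⊆X' Y⊆Y' = X'⊆X , Y'⊆Y
      where
      X'⊆X : X' ⊆ X
      X'⊆X v v∈X' with X v in v∉X
      ... | true  = refl
      ... | false with X-blocked v v∉X
      ...   | inj₁ v∈Y               = ⊥-elim (disjoint v v∈X' (Y⊆Y' v v∈Y))
      ...   | inj₂ (b , b∈Y , v→b) = ⊥-elim (no-edge v b v∈X' (Y⊆Y' b b∈Y) v→b)

      Y'⊆Y : Y' ⊆ Y
      Y'⊆Y v v∈Y' with Y v in v∉Y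
      ... | true  = refl
      ... | false with Y-blocked v v∉Y
      ...   | inj₁ v∈X               = ⊥-elim (disjoint v (X⊆X' v v∈X) v∈Y')
      ...   | inj₂ (a , a∈X , a→v) = ⊥-elim (no-edge a v (X⊆X' a a∈X) v∈Y' a→v)

  complementary-maximal : {X Y : Subset Vertex} → (∀ v → Y v ≡ not (X v)) →
                          (∀ a b → X a ≡ true → Y b ≡ true → ¬ Edge a b) →
                          IsMaxOrthogonal G X Y
  complementary-maximal {X} {Y} Y≡∁X no-edge =
    blocked⇒maximal (disjoint , no-edge)
      (λ v v∉X → inj₁ (trans (Y≡∁X v) (cong not v∉X)))
      (λ v v∉Y → inj₁ (not-injective (trans (sym (Y≡∁X v)) v∉Y)))
    where
    disjoint : ∀ v → X v ≡ true → Y v ≡ true → ⊥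
    disjoint v v∈X v∈Y = contradiction (trans (sym v∈Y) (trans (Y≡∁X v) (cong not v∈X))) λ ()

module _ (G : Digraph) (_≟_ : DecidableEquality (Digraph.Vertex G)) where
  open Digraph G

  maximal-absorbs : ∀ {X Y v} → IsMaxOrthogonal G X Y → Y v ≢ true →
                    (∀ b → Y b ≡ true → ¬ Edge v b) → X v ≡ true
  maximal-absorbs {X} {Y} {v} ((disjoint , no-edge) , maximal) v∉Y v↛Y =
    proj₁ (maximal X+v Y (disjoint′ , no-edge′) X⊆X+v (λ _ → id)) v v∈X+v
    where
    X+v : Subset Vertex
    X+v w = does (w ≟ v) ∨ X w
    v∈X+v : X+v v ≡ true
    v∈X+v rewrite dec-true (v ≟ v) refl = refl
    X⊆X+v : X ⊆ X+v
    X⊆X+v w w∈X with w ≟ v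
    ... | yes _ = refl
    ... | no  _ = w∈X
    disjoint′ : ∀ w → X+v w ≡ true → Y w ≡ true → ⊥
    disjoint′ w w∈X+v w∈Y with w ≟ v
    ... | yes refl = v∉Y w∈Y
    ... | no  _    = disjoint w w∈X+v w∈Y
    no-edge′ : ∀ a b → X+v a ≡ true → Y b ≡ true → ¬ Edge a b
    no-edge′ a b a∈X+v b∈Y with a ≟ v
    ... | yes refl = v↛Y b b∈Y
    ... | no  _    = no-edge a b a∈X+v b∈Y

  dominated-closed : ∀ {X Y a b} → IsMaxOrthogonal G X Y → Dominates G a b →
                     X a ≡ true → X b ≡ true
  dominated-closed {a = a} {b} max@((_ , no-edge) , _) (a→b , b→⇒a→) a∈X =
    maximal-absorbs max (λ b∈Y → no-edge a b a∈X b∈Y a→b)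
                        (λ c c∈Y b→c → no-edge a c a∈X c∈Y (b→⇒a→ c b→c))

  chain-traces-comparable : ∀ {k X Y X' Y'} (c : Fin k → Vertex) → IsDominationChain G c →
                            IsMaxOrthogonal G X Y → IsMaxOrthogonal G X' Y' →
                            Comparable (X ∘ c) (X' ∘ c)
  chain-traces-comparable {X = X} {X' = X'} c chain max max'
    with ⊆-or-counterexample (X ∘ c) (X' ∘ c)
  ... | inj₁ ⊆ = inj₁ ⊆
  ... | inj₂ (i , cᵢ∈X , cᵢ∉X') = inj₂ X'⊆X
    where
    X'⊆X : (X' ∘ c) ⊆ (X ∘ c)
    X'⊆X j cⱼ∈X' with i Fin.≟ j
    ... | yes refl = contradiction (trans (sym cᵢ∉X') cⱼ∈X') λ ()
    ... | no i≢j with chain i j i≢j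
    ...   | inj₁ cᵢ▷cⱼ = dominated-closed max cᵢ▷cⱼ cᵢ∈X
    ...   | inj₂ cⱼ▷cᵢ = contradiction (trans (sym cᵢ∉X') (dominated-closed max' cⱼ▷cᵢ cⱼ∈X')) λ ()

module Bubble (m n : ℕ) where

  G : Digraph
  G = BubGraph m n

  pattern x[_] s = inj₁ s
  pattern y[_] t = inj₂ (inj₁ t)
  pattern xy[_,_] s t = inj₂ (inj₂ (s , t))

  _≟ᵥ_ : DecidableEquality (BubVertex m n)
  _≟ᵥ_ = Sum.≡-dec Fin._≟_ (Sum.≡-dec Fin._≟_ (Product.≡-dec Fin._≟_ Fin._≟_))

  x-sink : ∀ {s} v → ¬ BubEdge m n x[ s ] v
  x-sink x[ _ ]     ()
  x-sink y[ _ ]     ()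
  x-sink xy[ _ , _ ] ()

  y-source : ∀ {t} v → ¬ BubEdge m n v y[ t ]
  y-source x[ _ ]     ()
  y-source y[ _ ]     ()
  y-source xy[ _ , _ ] ()

  xy-dominates-x : ∀ {s t} → Dominates G xy[ s , t ] x[ s ]
  xy-dominates-x {s} = refl , λ v x→v → ⊥-elim (x-sink {s} v x→v)

  xy-dominates-row : ∀ {s t t'} → t Fin.< t' → Dominates G xy[ s , t ] xy[ s , t' ]
  xy-dominates-row {s} {t} {t'} t<t' =
    ((ℕ.<⇒≢ t<t' ∘ cong Fin.toℕ ∘ proj₂) , Fin.≤-refl , ℕ.<⇒≤ t<t') , onwards
    where
    onwards : ∀ v → BubEdge m n xy[ s , t' ] v → BubEdge m n xy[ s , t ] v
    onwards x[ _ ]        s≡s'                   = s≡s'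
    onwards xy[ s'' , t'' ] (_ , s''≤s , t'≤t'') =
      (ℕ.<⇒≢ t<t'' ∘ cong Fin.toℕ ∘ proj₂) , s''≤s , ℕ.<⇒≤ t<t''
      where
      t<t'' : t Fin.< t''
      t<t'' = ℕ.<-≤-trans t<t' t'≤t''

  Letter : Set
  Letter = Fin m ⊎ Fin n

  width : Letter → ℕ
  width (inj₁ _) = suc n
  width (inj₂ _) = 1

  column : (ℓ : Letter) → Fin (width ℓ) → BubVertex m n
  column (inj₁ s) zero    = x[ s ]
  column (inj₁ s) (suc t) = xy[ s , t ]
  column (inj₂ t) zero    = y[ t ]

  columns-cover : ∀ v → ∃[ ℓ ] ∃[ i ] column ℓ i ≡ v
  columns-cover x[ s ]      = inj₁ s , zero , refl
  columns-cover y[ t ]      = inj₂ t , zero , refl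
  columns-cover xy[ s , t ] = inj₁ s , suc t , refl

  column-chain : ∀ ℓ → IsDominationChain G (column ℓ)
  column-chain (inj₁ s) zero    zero     0≢0 = contradiction refl 0≢0
  column-chain (inj₁ s) zero    (suc t)  _   = inj₂ xy-dominates-x
  column-chain (inj₁ s) (suc t) zero     _   = inj₁ xy-dominates-x
  column-chain (inj₁ s) (suc t) (suc t') t≢t' with Fin.<-cmp t t'
  ... | tri< t<t' _ _ = inj₁ (xy-dominates-row t<t')
  ... | tri≈ _ t≡t' _ = contradiction (cong suc t≡t') t≢t'
  ... | tri> _ _ t'<t = inj₂ (xy-dominates-row t'<t)
  column-chain (inj₂ t) zero    zero     0≢0 = contradiction refl 0≢0

  coordinates : MOP G → Letter → ℕ
  coordinates ((X , _) , _) ℓ = size (X ∘ column ℓ)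

  coordinates-embedding : ∀ P Q → _≤L_ G P Q ⇔ (∀ ℓ → coordinates P ℓ ℕ.≤ coordinates Q ℓ)
  coordinates-embedding (_ , P-max) (_ , Q-max) =
    ⊆⇔column-sizes≤ column columns-cover
      (λ ℓ → chain-traces-comparable G _≟ᵥ_ (column ℓ) (column-chain ℓ) P-max Q-max)

  letter : Letter → BubVertex m n
  letter (inj₁ s) = x[ s ]
  letter (inj₂ t) = y[ t ]

  singleton : BubVertex m n → Subset (BubVertex m n)
  singleton v w = does (w ≟ᵥ v)

  ∈-singleton : ∀ v w → singleton v w ≡ true → w ≡ v
  ∈-singleton v w with w ≟ᵥ v
  ... | yes w≡v = λ _ → w≡v
  ... | no  _   = λ ()

  singleton-⊆ : ∀ {v A} → A v ≡ true → singleton v ⊆ A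
  singleton-⊆ {v} {A} v∈A w w∈singleton =
    subst (λ u → A u ≡ true) (sym (∈-singleton _ w w∈singleton)) v∈A

  ⊆-singleton⁻ : ∀ {v A} → singleton v ⊆ A → A v ≡ true
  ⊆-singleton⁻ {v} v⊆A = v⊆A v (dec-true (v ≟ᵥ v) refl)

  avoids : Letter → Subset (BubVertex m n)
  avoids (inj₁ s) x[ s' ]       = not (does (s' Fin.≟ s))
  avoids (inj₁ s) y[ _ ]        = true
  avoids (inj₁ s) xy[ s' , _ ]  = not (does (s' Fin.≟ s))
  avoids (inj₂ t) x[ _ ]        = true
  avoids (inj₂ t) y[ t' ]       = not (does (t' Fin.≟ t))
  avoids (inj₂ t) xy[ _ , t' ]  = not (does (t' Fin.≟ t))

  not-≟-refl : ∀ {k} (i : Fin k) → not (does (i Fin.≟ i)) ≡ false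
  not-≟-refl i = cong not (dec-true (i Fin.≟ i) refl)

  atomY : Letter → Subset (BubVertex m n)
  atomY (inj₁ s) = not ∘ singleton x[ s ]
  atomY (inj₂ t) = avoids (inj₂ t)

  atom-maximal : ∀ ℓ → IsMaxOrthogonal G (singleton (letter ℓ)) (atomY ℓ)
  atom-maximal (inj₁ s) = complementary-maximal G (λ _ → refl) no-edge
    where
    no-edge : ∀ a b → singleton x[ s ] a ≡ true → atomY (inj₁ s) b ≡ true → ¬ BubEdge m n a b
    no-edge a b a∈X _ with ∈-singleton x[ s ] a a∈X
    ... | refl = x-sink {s} b
  atom-maximal (inj₂ t) = blocked⇒maximal G (disjoint , no-edge) X-blocked Y-blocked
    where
    disjoint : ∀ v → singleton y[ t ] v ≡ true → avoids (inj₂ t) v ≡ true → ⊥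
    disjoint v v∈X v∈Y with ∈-singleton y[ t ] v v∈X
    ... | refl = contradiction (trans (sym v∈Y) (not-≟-refl t)) λ ()
    no-edge : ∀ a b → singleton y[ t ] a ≡ true → avoids (inj₂ t) b ≡ true → ¬ BubEdge m n a b
    no-edge a b a∈X b∈Y a→b with ∈-singleton y[ t ] a a∈X
    no-edge _ xy[ s , t ] _ b∈Y refl | refl = contradiction (trans (sym b∈Y) (not-≟-refl t)) λ ()
    X-blocked : ∀ v → singleton y[ t ] v ≡ false →
                avoids (inj₂ t) v ≡ true ⊎ ∃[ b ] (avoids (inj₂ t) b ≡ true × BubEdge m n v b)
    X-blocked x[ _ ]       _    = inj₁ refl
    X-blocked y[ t' ]      v∉X  = inj₁ (cong not v∉X)
    X-blocked xy[ s , t' ] _ with t' Fin.≟ t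
    ... | yes _ = inj₂ (x[ s ] , refl , refl)
    ... | no  _ = inj₁ refl
    Y-blocked : ∀ v → avoids (inj₂ t) v ≡ false →
                singleton y[ t ] v ≡ true ⊎ ∃[ a ] (singleton y[ t ] a ≡ true × BubEdge m n a v)
    Y-blocked y[ t' ] v∉Y = inj₁ (not-injective v∉Y)
    Y-blocked xy[ s , t' ] v∉Y with t' Fin.≟ t
    ... | yes refl = inj₂ (y[ t ] , dec-true (y[ t ] ≟ᵥ y[ t ]) refl , refl)

  coatomX : Letter → Subset (BubVertex m n)
  coatomX (inj₁ s) = avoids (inj₁ s)
  coatomX (inj₂ t) = not ∘ singleton y[ t ]

  coatom-maximal : ∀ ℓ → IsMaxOrthogonal G (coatomX ℓ) (singleton (letter ℓ))
  coatom-maximal (inj₁ s) = blocked⇒maximal G (disjoint , no-edge) X-blocked Y-blocked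
    where
    disjoint : ∀ v → avoids (inj₁ s) v ≡ true → singleton x[ s ] v ≡ true → ⊥
    disjoint v v∈X v∈Y with ∈-singleton x[ s ] v v∈Y
    ... | refl = contradiction (trans (sym v∈X) (not-≟-refl s)) λ ()
    no-edge : ∀ a b → avoids (inj₁ s) a ≡ true → singleton x[ s ] b ≡ true → ¬ BubEdge m n a b
    no-edge a b a∈X b∈Y a→b with ∈-singleton x[ s ] b b∈Y
    no-edge xy[ s , _ ] _ a∈X _ refl | refl = contradiction (trans (sym a∈X) (not-≟-refl s)) λ ()
    X-blocked : ∀ v → avoids (inj₁ s) v ≡ false →
                singleton x[ s ] v ≡ true ⊎ ∃[ b ] (singleton x[ s ] b ≡ true × BubEdge m n v b)
    X-blocked x[ s' ] v∉X = inj₁ (not-injective v∉X)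
    X-blocked xy[ s' , t ] v∉X with s' Fin.≟ s
    ... | yes refl = inj₂ (x[ s ] , dec-true (x[ s ] ≟ᵥ x[ s ]) refl , refl)
    Y-blocked : ∀ v → singleton x[ s ] v ≡ false →
                avoids (inj₁ s) v ≡ true ⊎ ∃[ a ] (avoids (inj₁ s) a ≡ true × BubEdge m n a v)
    Y-blocked x[ s' ]      v∉Y = inj₁ (cong not v∉Y)
    Y-blocked y[ _ ]       _   = inj₁ refl
    Y-blocked xy[ s' , t ] _ with s' Fin.≟ s
    ... | yes refl = inj₂ (y[ t ] , refl , refl)
    ... | no  _    = inj₁ refl
  coatom-maximal (inj₂ t) =
    complementary-maximal G (λ _ → sym (not-involutive _)) no-edge
    where
    no-edge : ∀ a b → coatomX (inj₂ t) a ≡ true → singleton y[ t ] b ≡ true → ¬ BubEdge m n a b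
    no-edge a b _ b∈Y with ∈-singleton y[ t ] b b∈Y
    ... | refl = y-source a

  atom coatom : Letter → MOP G
  atom   ℓ = (singleton (letter ℓ) , atomY ℓ) , atom-maximal ℓ
  coatom ℓ = (coatomX ℓ , singleton (letter ℓ)) , coatom-maximal ℓ

  letter-∈-coatomX : ∀ ℓ ℓ' → ℓ ≢ ℓ' → coatomX ℓ' (letter ℓ) ≡ true
  letter-∈-coatomX (inj₁ s) (inj₁ s') s≢s' = cong not (dec-false (s Fin.≟ s') (s≢s' ∘ cong inj₁))
  letter-∈-coatomX (inj₁ s) (inj₂ t') _    = refl
  letter-∈-coatomX (inj₂ t) (inj₁ s') _    = refl
  letter-∈-coatomX (inj₂ t) (inj₂ t') t≢t' = cong not (dec-false (t Fin.≟ t') (t≢t' ∘ cong inj₂))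

  letter-∉-coatomX : ∀ ℓ → coatomX ℓ (letter ℓ) ≡ false
  letter-∉-coatomX (inj₁ s) = not-≟-refl s
  letter-∉-coatomX (inj₂ t) = not-≟-refl t

  embedsIn-m+n : EmbedsIn (Bub m n) (m + n)
  embedsIn-m+n = embedsIn-ℕ (Bub m n) Fin.+↔⊎ coordinates coordinates-embedding

  embedsIn⇒m+n≤ : ∀ d → EmbedsIn (Bub m n) d → m + n ℕ.≤ d
  embedsIn⇒m+n≤ _ = standard-example⇒≤ (Bub m n) (↔⇒↣ Fin.+↔⊎) atom coatom atom≤coatom atom≰coatom
    where
    atom≤coatom : ∀ ℓ ℓ' → ℓ ≢ ℓ' → _≤L_ G (atom ℓ) (coatom ℓ')
    atom≤coatom ℓ ℓ' ℓ≢ℓ' = singleton-⊆ (letter-∈-coatomX ℓ ℓ' ℓ≢ℓ')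
    atom≰coatom : ∀ ℓ → ¬ _≤L_ G (atom ℓ) (coatom ℓ)
    atom≰coatom ℓ atom≤coatom =
      contradiction (trans (sym (⊆-singleton⁻ atom≤coatom)) (letter-∉-coatomX ℓ)) λ ()

proposition4p4 : (m n : ℕ) → HasOrderDimension (Bub m n) (m + n)
proposition4p4 m n = embedsIn-m+n , embedsIn⇒m+n≤
  where open Bubble m n
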